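{- Let $c \geq 2$ be a constant. There is a constant $\kappa_c > 0$ such that for every even integer $d \geq 2$ there are $\binom{d}{d/2}$ pairs $(x_i,y_i)\in\binom{[d]}{d/2}\times\{0,1\}$ such that every function $f:\{0,1\}^d\to\{0,1\}$ satisfying $f(x_i) = y_i$ for all $i=1,\ldots,\binom{d}{d/2}$ requires formulas of fan-in at most $c$ of size at least $\kappa_c\cdot 2^d/(d^{1/2}\log d)$.
   Context: $\binom{[d]}{k}$ denotes the set of all vectors in $\{0,1\}^d$ of Hamming weight exactly $k$. A formula of fan-in $c$ is a rooted tree whose leaves are labeled by input variables or constants and whose internal gates compute arbitrary Boolean functions of at most $c$ inputs; its size is its number of nodes. -}

module Defs where

open import Data.Nat using (ℕ; zero; suc; _+_; _≤_)
open import Data.Bool using (Bool; true; false)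
open import Data.Fin using (Fin)
open import Data.Vec using (Vec; []; _∷_; lookup)

weight : ∀ {n} → Vec Bool n → ℕ
weight [] = 0
weight (true ∷ xs) = suc (weight xs)
weight (false ∷ xs) = weight xs

data Formula (c d : ℕ) : Set where
  var   : Fin d → Formula c d
  const : Bool → Formula c d
  gate  : (k : ℕ) → k ≤ c → (Vec Bool k → Bool) → Vec (Formula c d) k → Formula c d

mutual
  eval : ∀ {c d} → Formula c d → Vec Bool d → Bool
  eval (var i) x = lookup x i
  eval (const b) x = b
  eval (gate k _ g fs) x = g (evalAll fs x)

  evalAll : ∀ {c d k} → Vec (Formula c d) k → Vec Bool d → Vec Bool k
  evalAll [] x = []
  evalAll (f ∷ fs) x = eval f x ∷ evalAll fs x

mutual
  size : ∀ {c d} → Formula c d → ℕ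
  size (var i) = 1
  size (const b) = 1
  size (gate k _ g fs) = suc (sizeAll fs)

  sizeAll : ∀ {c d k} → Vec (Formula c d) k → ℕ
  sizeAll [] = 0
  sizeAll (f ∷ fs) = size f + sizeAll fs

module Submission where

-- A formula of fan-in c and size s over d ≤ 2^L variables has a prefix-free binary code of length
-- at most (4 + c + 2^c + L)·s from which its values can be decoded. The N = C(2m,m) points of
-- weight m admit 2^N labellings, but strings of length below N decode to at most 2^(N-1) of them,
-- so some labelling forces every consistent formula to have a code of length at least N, that is
-- size at least N/(4 + c + 2^c + L). Finally C(2m,m)²·4m ≥ 16^m, and L = ⌈log₂ 2m⌉ suffices.

open import Defs
open import Data.Nat using (ℕ; _+_; _*_; _^_; _≤_; _<_)
open import Data.Nat.Combinatorics using (_C_)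
open import Data.Nat.Logarithm using (⌈log₂_⌉)
open import Data.Bool using (Bool)
open import Data.Vec using (Vec)
open import Data.Product using (Σ; _×_; _,_; proj₁; proj₂; ∃)
open import Data.List using (List; length; map)
open import Data.List.Relation.Unary.All using (All)
open import Data.List.Relation.Unary.Unique.Propositional using (Unique)
open import Relation.Binary.PropositionalEquality using (_≡_)

open import Data.Nat using (zero; suc; z≤n; s≤s; _∸_; _<?_; _≤?_; ⌈_/2⌉; ⌊_/2⌋)
open import Data.Nat.Properties
open import Data.Nat.Combinatorics using (nCk+nC[k+1]≡[n+1]C[k+1]; nCk≡nC[n∸k]; nC1≡n)
open import Data.Nat.Logarithm using (⌈log₂⌉-mono-≤)
open import Data.Nat.Logarithm.Core using (⌈log2⌉)
open import Data.Nat.Induction using (<-wellFounded)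
open import Data.Nat.Tactic.RingSolver using (solve-∀)
open import Induction.WellFounded using (Acc; acc)
open import Data.Bool using (true; false)
open import Data.Fin using (Fin; toℕ)
import Data.Fin as Fin
open import Data.Fin.Properties using (toℕ<n)
open import Data.Vec as Vec using ([]; _∷_; lookup)
import Data.Vec.Properties as Vecₚ
open import Data.List using ([]; _∷_; _++_; replicate; zip)
open import Data.List.Properties using (++-assoc; length-++; length-map; length-replicate; map-cong)
open import Data.List.Relation.Unary.All as All using ([]; _∷_)
import Data.List.Relation.Unary.All.Properties as Allₚ
import Data.List.Relation.Unary.AllPairs as AllPairs
open import Data.List.Relation.Unary.Any using (here; there)
import Data.List.Relation.Unary.Unique.Propositional.Properties as Uniqueₚ
open import Data.List.Membership.Propositional using (_∈_; _∉_)
open import Data.List.Membership.Propositional.Properties using (∈-map⁺; ∈-map⁻; ∈-++⁺ˡ; ∈-++⁺ʳ)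
open import Data.Empty using (⊥-elim)
open import Function using (_∘_)
open import Relation.Nullary using (¬_; yes; no)
open import Relation.Binary.PropositionalEquality using (refl; sym; trans; cong; cong₂; subst; module ≡-Reasoning)

[1+k]*[1+n]C[1+k]≡[1+n]*nCk : ∀ n k → suc k * (suc n C suc k) ≡ suc n * (n C k)
[1+k]*[1+n]C[1+k]≡[1+n]*nCk zero    zero    = refl
[1+k]*[1+n]C[1+k]≡[1+n]*nCk zero    (suc k) = *-zeroʳ (2 + k)
[1+k]*[1+n]C[1+k]≡[1+n]*nCk (suc n) zero    =
  trans (*-identityˡ _) (trans (nC1≡n (2 + n)) (sym (*-identityʳ _)))
[1+k]*[1+n]C[1+k]≡[1+n]*nCk (suc n) (suc k) = begin
  suc (suc k) * (suc (suc n) C suc (suc k))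
    ≡⟨ cong (suc (suc k) *_) (sym (nCk+nC[k+1]≡[n+1]C[k+1] (suc n) (suc k))) ⟩
  suc (suc k) * (suc n C suc k + suc n C suc (suc k))
    ≡⟨ *-distribˡ-+ (suc (suc k)) (suc n C suc k) _ ⟩
  (suc n C suc k + suc k * (suc n C suc k)) + suc (suc k) * (suc n C suc (suc k))
    ≡⟨ cong₂ (λ u v → (suc n C suc k + u) + v)
             ([1+k]*[1+n]C[1+k]≡[1+n]*nCk n k) ([1+k]*[1+n]C[1+k]≡[1+n]*nCk n (suc k)) ⟩
  (suc n C suc k + suc n * (n C k)) + suc n * (n C suc k)
    ≡⟨ +-assoc (suc n C suc k) _ _ ⟩
  suc n C suc k + (suc n * (n C k) + suc n * (n C suc k))
    ≡⟨ cong (suc n C suc k +_) (sym (*-distribˡ-+ (suc n) (n C k) _)) ⟩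
  suc n C suc k + suc n * (n C k + n C suc k)
    ≡⟨ cong (λ z → suc n C suc k + suc n * z) (nCk+nC[k+1]≡[n+1]C[k+1] n k) ⟩
  suc (suc n) * (suc n C suc k) ∎
  where open ≡-Reasoning

centralBinomial : ℕ → ℕ
centralBinomial m = (2 * m) C m

centralBinomial-suc : ∀ m → suc m * centralBinomial (suc m) ≡ 2 * (suc (2 * m) * centralBinomial m)
centralBinomial-suc m = begin
  suc m * ((2 * suc m) C suc m)
    ≡⟨ cong (λ z → suc m * (z C suc m)) (*-suc 2 m) ⟩
  suc m * (suc (suc n) C suc m)
    ≡⟨ cong (suc m *_) (sym (nCk+nC[k+1]≡[n+1]C[k+1] (suc n) m)) ⟩
  suc m * (suc n C m + suc n C suc m)
    ≡⟨ cong (λ z → suc m * (z + suc n C suc m)) symmetric ⟩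
  suc m * (suc n C suc m + suc n C suc m)
    ≡⟨ *-distribˡ-+ (suc m) (suc n C suc m) _ ⟩
  suc m * (suc n C suc m) + suc m * (suc n C suc m)
    ≡⟨ cong₂ _+_ ([1+k]*[1+n]C[1+k]≡[1+n]*nCk n m) ([1+k]*[1+n]C[1+k]≡[1+n]*nCk n m) ⟩
  suc n * (n C m) + suc n * (n C m)
    ≡⟨ cong (suc n * (n C m) +_) (sym (+-identityʳ _)) ⟩
  2 * (suc n * centralBinomial m) ∎
  where
  open ≡-Reasoning
  n = 2 * m
  [1+2m]∸m≡1+m : suc n ∸ m ≡ suc m
  [1+2m]∸m≡1+m = begin
    suc (m + (m + 0)) ∸ m ≡⟨ cong (_∸ m) (sym (+-suc m (m + 0))) ⟩
    m + suc (m + 0) ∸ m   ≡⟨ m+n∸m≡n m (suc (m + 0)) ⟩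
    suc (m + 0)           ≡⟨ cong suc (+-identityʳ m) ⟩
    suc m                 ∎
  symmetric : suc n C m ≡ suc n C suc m
  symmetric = trans (nCk≡nC[n∸k] (≤-trans (m≤m+n m (m + 0)) (n≤1+n _))) (cong (suc n C_) [1+2m]∸m≡1+m)

-- Consecutive terms of C(2m,m)²·4m/16^m have ratio (2m+1)²/(4m(m+1)) ≥ 1; the step multiplies through by (m+1)m.
centralBinomial-lower-bound : ∀ m → 2 ^ (2 * suc m) * 2 ^ (2 * suc m)
                                    ≤ centralBinomial (suc m) * centralBinomial (suc m) * (4 * suc m)
centralBinomial-lower-bound zero    = ≤-refl
centralBinomial-lower-bound (suc j) = *-cancelʳ-≤ _ _ (suc m * m) step
  where
  m = suc j
  X = 2 ^ (2 * m)
  a = centralBinomial m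
  b = centralBinomial (suc m)
  4m[m+1]<[2m+1]² : 4 * m * suc m ≤ suc (2 * m) * suc (2 * m)
  4m[m+1]<[2m+1]² = subst (4 * m * suc m ≤_) (sym (square m)) (n≤1+n _)
    where
    square : ∀ m → suc (2 * m) * suc (2 * m) ≡ suc (4 * m * suc m)
    square = solve-∀
  2^[2m+2]≡4*2^[2m] : 2 ^ (2 * suc m) ≡ 4 * X
  2^[2m+2]≡4*2^[2m] = trans (cong (2 ^_) (*-suc 2 m)) (sym (*-assoc 2 2 X))
  open ≤-Reasoning
  step : 2 ^ (2 * suc m) * 2 ^ (2 * suc m) * (suc m * m) ≤ b * b * (4 * suc m) * (suc m * m)
  step = begin
    2 ^ (2 * suc m) * 2 ^ (2 * suc m) * (suc m * m)
      ≡⟨ cong (λ u → u * u * (suc m * m)) 2^[2m+2]≡4*2^[2m] ⟩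
    4 * X * (4 * X) * (suc m * m)
      ≡⟨ regroup₁ X m ⟩
    16 * (X * X * (suc m * m))
      ≤⟨ *-monoʳ-≤ 16 (*-monoˡ-≤ (suc m * m) (centralBinomial-lower-bound j)) ⟩
    16 * (a * a * (4 * m) * (suc m * m))
      ≡⟨ regroup₂ a m ⟩
    16 * (a * a * m) * (4 * m * suc m)
      ≤⟨ *-monoʳ-≤ (16 * (a * a * m)) 4m[m+1]<[2m+1]² ⟩
    16 * (a * a * m) * (suc (2 * m) * suc (2 * m))
      ≡⟨ regroup₃ a m ⟩
    4 * m * (2 * (suc (2 * m) * a) * (2 * (suc (2 * m) * a)))
      ≡⟨ cong (λ z → 4 * m * (z * z)) (sym (centralBinomial-suc m)) ⟩
    4 * m * (suc m * b * (suc m * b))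
      ≡⟨ regroup₄ b m ⟩
    b * b * (4 * suc m) * (suc m * m) ∎
    where
    regroup₁ : ∀ X m → 4 * X * (4 * X) * (suc m * m) ≡ 16 * (X * X * (suc m * m))
    regroup₁ = solve-∀
    regroup₂ : ∀ a m → 16 * (a * a * (4 * m) * (suc m * m)) ≡ 16 * (a * a * m) * (4 * m * suc m)
    regroup₂ = solve-∀
    regroup₃ : ∀ a m → 16 * (a * a * m) * (suc (2 * m) * suc (2 * m))
                     ≡ 4 * m * (2 * (suc (2 * m) * a) * (2 * (suc (2 * m) * a)))
    regroup₃ = solve-∀
    regroup₄ : ∀ b m → 4 * m * (suc m * b * (suc m * b)) ≡ b * b * (4 * suc m) * (suc m * m)
    regroup₄ = solve-∀

Parser : Set → Set
Parser A = List Bool → A × List Bool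

bits : ℕ → ℕ → List Bool
bits zero    j = []
bits (suc L) j with j <? 2 ^ L
... | yes _ = false ∷ bits L j
... | no  _ = true  ∷ bits L (j ∸ 2 ^ L)

readBits : ℕ → Parser ℕ
readBits zero    r           = 0 , r
readBits (suc L) []          = 0 , []
readBits (suc L) (false ∷ r) = readBits L r
readBits (suc L) (true  ∷ r) = let j , r′ = readBits L r in 2 ^ L + j , r′

length-bits : ∀ L j → length (bits L j) ≡ L
length-bits zero    j = refl
length-bits (suc L) j with j <? 2 ^ L
... | yes _ = cong suc (length-bits L j)
... | no  _ = cong suc (length-bits L (j ∸ 2 ^ L))

readBits-bits : ∀ L j r → j < 2 ^ L → readBits L (bits L j ++ r) ≡ (j , r)
readBits-bits zero    zero    r _          = refl
readBits-bits zero    (suc j) r (s≤s ())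
readBits-bits (suc L) j       r j<2^[1+L] with j <? 2 ^ L
... | yes j<2^L = readBits-bits L j r j<2^L
... | no  j≮2^L rewrite readBits-bits L (j ∸ 2 ^ L) r (m<n+o⇒m∸n<o j (2 ^ L) {{m^n≢0 2 L}}
                                (subst (j <_) (cong (2 ^ L +_) (+-identityʳ _)) j<2^[1+L])) =
  cong (_, r) (m+[n∸m]≡n (≮⇒≥ j≮2^L))

unary : ℕ → List Bool
unary zero    = false ∷ []
unary (suc k) = true ∷ unary k

readUnary : Parser ℕ
readUnary []          = 0 , []
readUnary (false ∷ r) = 0 , r
readUnary (true  ∷ r) = let k , r′ = readUnary r in suc k , r′

length-unary : ∀ k → length (unary k) ≡ suc k
length-unary zero    = refl
length-unary (suc k) = cong suc (length-unary k)

readUnary-unary : ∀ k r → readUnary (unary k ++ r) ≡ (k , r)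
readUnary-unary zero    r = refl
readUnary-unary (suc k) r rewrite readUnary-unary k r = refl

truthTable : (k : ℕ) → (Vec Bool k → Bool) → List Bool
truthTable zero    g = g [] ∷ []
truthTable (suc k) g = truthTable k (g ∘ (false ∷_)) ++ truthTable k (g ∘ (true ∷_))

branch : ∀ {k} {A : Set} → (Vec Bool k → A) → (Vec Bool k → A) → Vec Bool (suc k) → A
branch g₀ g₁ (false ∷ v) = g₀ v
branch g₀ g₁ (true  ∷ v) = g₁ v

readTable : (k : ℕ) → Parser (Vec Bool k → Bool)
readTable zero    []      = (λ _ → false) , []
readTable zero    (b ∷ r) = (λ _ → b) , r
readTable (suc k) r       =
  let t₀ , r₁ = readTable k r
      t₁ , r₂ = readTable k r₁
  in branch t₀ t₁ , r₂

length-truthTable : ∀ k g → length (truthTable k g) ≡ 2 ^ k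
length-truthTable zero    g = refl
length-truthTable (suc k) g = begin
  length (truthTable k _ ++ truthTable k _)         ≡⟨ length-++ (truthTable k _) ⟩
  length (truthTable k _) + length (truthTable k _) ≡⟨ cong₂ _+_ (length-truthTable k _) (length-truthTable k _) ⟩
  2 ^ k + 2 ^ k                                     ≡⟨ cong (2 ^ k +_) (sym (+-identityʳ _)) ⟩
  2 ^ suc k                                         ∎
  where open ≡-Reasoning

readTable-truthTable : ∀ k g r →
  proj₂ (readTable k (truthTable k g ++ r)) ≡ r × (∀ v → proj₁ (readTable k (truthTable k g ++ r)) v ≡ g v)
readTable-truthTable zero    g r = refl , λ { [] → refl }
readTable-truthTable (suc k) g r
  rewrite ++-assoc (truthTable k (g ∘ (false ∷_))) (truthTable k (g ∘ (true ∷_))) r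
  with readTable-truthTable k (g ∘ (false ∷_)) (truthTable k (g ∘ (true ∷_)) ++ r)
... | rest₀ , t₀≗g₀ rewrite rest₀ with readTable-truthTable k (g ∘ (true ∷_)) r
... | rest₁ , t₁≗g₁ = rest₁ , λ { (false ∷ v) → t₀≗g₀ v ; (true ∷ v) → t₁≗g₁ v }

BoolFn : ℕ → Set
BoolFn d = Vec Bool d → Bool

lookupℕ : ∀ {d} → Vec Bool d → ℕ → Bool
lookupℕ []      _       = false
lookupℕ (b ∷ _) zero    = b
lookupℕ (_ ∷ x) (suc j) = lookupℕ x j

lookupℕ-toℕ : ∀ {d} (x : Vec Bool d) (i : Fin d) → lookupℕ x (toℕ i) ≡ lookup x i
lookupℕ-toℕ (b ∷ x) Fin.zero    = refl
lookupℕ-toℕ (b ∷ x) (Fin.suc i) = lookupℕ-toℕ x i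

module FormulaCode (c d L : ℕ) where

  mutual
    encode : Formula c d → List Bool
    encode (var i)          = true ∷ true ∷ bits L (toℕ i)
    encode (const b)        = true ∷ false ∷ b ∷ []
    encode (gate k _ g fs)  = false ∷ (unary k ++ (truthTable k g ++ encodeAll fs))

    encodeAll : ∀ {k} → Vec (Formula c d) k → List Bool
    encodeAll []       = []
    encodeAll (f ∷ fs) = encode f ++ encodeAll fs

  -- The ℕ argument is fuel; size F of it suffices to decode F.
  mutual
    decode : ℕ → Parser (BoolFn d)
    decode (suc n) (true ∷ true ∷ r)      = let j , r′ = readBits L r in (λ x → lookupℕ x j) , r′
    decode (suc n) (true ∷ false ∷ b ∷ r) = (λ _ → b) , r
    decode (suc n) (false ∷ r)            =
      let k  , r₁ = readUnary r
          t  , r₂ = readTable k r₁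
          hs , r₃ = decodeAll n k r₂
      in (λ x → t (Vec.map (λ h → h x) hs)) , r₃
    decode _       r                      = (λ _ → false) , r

    decodeAll : ℕ → (k : ℕ) → Parser (Vec (BoolFn d) k)
    decodeAll n zero    r = [] , r
    decodeAll n (suc k) r =
      let h  , r₁ = decode n r
          hs , r₂ = decodeAll n k r₁
      in h ∷ hs , r₂

  module _ (d≤2^L : d ≤ 2 ^ L) where
    mutual
      decode-encode : ∀ n (F : Formula c d) → size F ≤ n → ∀ r →
        proj₂ (decode n (encode F ++ r)) ≡ r × (∀ x → proj₁ (decode n (encode F ++ r)) x ≡ eval F x)
      decode-encode (suc n) (var i) _ r
        rewrite readBits-bits L (toℕ i) r (≤-trans (toℕ<n i) d≤2^L) = refl , λ x → lookupℕ-toℕ x i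
      decode-encode (suc n) (const b) _ r = refl , λ _ → refl
      decode-encode (suc n) (gate k _ g fs) (s≤s sizeAll≤n) r
        rewrite ++-assoc (unary k) (truthTable k g ++ encodeAll fs) r
              | ++-assoc (truthTable k g) (encodeAll fs) r
              | readUnary-unary k (truthTable k g ++ (encodeAll fs ++ r))
        with readTable-truthTable k g (encodeAll fs ++ r)
      ... | rest , t≗g rewrite rest with decodeAll-encodeAll n fs sizeAll≤n r
      ... | rest′ , hs≗fs = rest′ , λ x → trans (t≗g _) (cong g (hs≗fs x))

      decodeAll-encodeAll : ∀ n {k} (fs : Vec (Formula c d) k) → sizeAll fs ≤ n → ∀ r →
        proj₂ (decodeAll n k (encodeAll fs ++ r)) ≡ r ×
        (∀ x → Vec.map (λ h → h x) (proj₁ (decodeAll n k (encodeAll fs ++ r))) ≡ evalAll fs x)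
      decodeAll-encodeAll n []       _ r = refl , λ _ → refl
      decodeAll-encodeAll n (f ∷ fs) sizeAll≤n r
        rewrite ++-assoc (encode f) (encodeAll fs) r
        with decode-encode n f (≤-trans (m≤m+n (size f) (sizeAll fs)) sizeAll≤n) (encodeAll fs ++ r)
      ... | rest , h≗f rewrite rest
        with decodeAll-encodeAll n fs (≤-trans (m≤n+m (sizeAll fs) (size f)) sizeAll≤n) r
      ... | rest′ , hs≗fs = rest′ , λ x → cong₂ _∷_ (h≗f x) (hs≗fs x)

  codeWidth : ℕ
  codeWidth = 4 + c + 2 ^ c + L

  gateHeader≤codeWidth : ∀ {k} → k ≤ c → 2 + k + 2 ^ k ≤ codeWidth
  gateHeader≤codeWidth k≤c = ≤-trans (+-mono-≤ (+-monoʳ-≤ 2 k≤c) (^-monoʳ-≤ 2 k≤c))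
                                     (≤-trans (m≤n+m _ 2) (m≤m+n _ L))

  mutual
    length-encode : ∀ F → length (encode F) ≤ codeWidth * size F
    length-encode (var i) rewrite length-bits L (toℕ i) | *-identityʳ codeWidth =
      +-monoˡ-≤ L (s≤s (s≤s z≤n))
    length-encode (const b) rewrite *-identityʳ codeWidth = s≤s (s≤s (s≤s z≤n))
    length-encode (gate k k≤c g fs) = begin
      suc (length (unary k ++ (truthTable k g ++ encodeAll fs)))
        ≡⟨ cong suc (length-++ (unary k)) ⟩
      suc (length (unary k) + length (truthTable k g ++ encodeAll fs))
        ≡⟨ cong₂ (λ u v → suc (u + v)) (length-unary k) (length-++ (truthTable k g)) ⟩
      2 + k + (length (truthTable k g) + length (encodeAll fs))
        ≡⟨ cong (λ u → 2 + k + (u + length (encodeAll fs))) (length-truthTable k g) ⟩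
      2 + k + (2 ^ k + length (encodeAll fs))
        ≡⟨ +-assoc (2 + k) (2 ^ k) _ ⟨
      2 + k + 2 ^ k + length (encodeAll fs)
        ≤⟨ +-mono-≤ (gateHeader≤codeWidth k≤c) (length-encodeAll fs) ⟩
      codeWidth + codeWidth * sizeAll fs
        ≡⟨ *-suc codeWidth (sizeAll fs) ⟨
      codeWidth * suc (sizeAll fs) ∎
      where open ≤-Reasoning

    length-encodeAll : ∀ {k} (fs : Vec (Formula c d) k) → length (encodeAll fs) ≤ codeWidth * sizeAll fs
    length-encodeAll []       = z≤n
    length-encodeAll (f ∷ fs) rewrite length-++ (encode f) {encodeAll fs}
                                    | *-distribˡ-+ codeWidth (size f) (sizeAll fs) =
      +-mono-≤ (length-encode f) (length-encodeAll fs)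

  mutual
    size≤length-encode : ∀ F → size F ≤ length (encode F)
    size≤length-encode (var i)   = s≤s z≤n
    size≤length-encode (const b) = s≤s z≤n
    size≤length-encode (gate k _ g fs)
      rewrite length-++ (unary k) {truthTable k g ++ encodeAll fs} | length-++ (truthTable k g) {encodeAll fs} =
      s≤s (≤-trans (sizeAll≤length-encodeAll fs)
                 (≤-trans (m≤n+m _ (length (truthTable k g))) (m≤n+m _ (length (unary k)))))

    sizeAll≤length-encodeAll : ∀ {k} (fs : Vec (Formula c d) k) → sizeAll fs ≤ length (encodeAll fs)
    sizeAll≤length-encodeAll []       = z≤n
    sizeAll≤length-encodeAll (f ∷ fs) rewrite length-++ (encode f) {encodeAll fs} =
      +-mono-≤ (size≤length-encode f) (sizeAll≤length-encodeAll fs)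

bitStrings : ℕ → List (List Bool)
bitStrings zero    = [] ∷ []
bitStrings (suc n) = map (false ∷_) (bitStrings n) ++ map (true ∷_) (bitStrings n)

length-bitStrings : ∀ n → length (bitStrings n) ≡ 2 ^ n
length-bitStrings zero    = refl
length-bitStrings (suc n) = begin
  length (map (false ∷_) (bitStrings n) ++ map (true ∷_) (bitStrings n))
    ≡⟨ length-++ (map (false ∷_) (bitStrings n)) ⟩
  length (map (false ∷_) (bitStrings n)) + length (map (true ∷_) (bitStrings n))
    ≡⟨ cong₂ _+_ (length-map _ (bitStrings n)) (length-map _ (bitStrings n)) ⟩
  length (bitStrings n) + length (bitStrings n)
    ≡⟨ cong₂ _+_ (length-bitStrings n) (trans (length-bitStrings n) (sym (+-identityʳ _))) ⟩
  2 ^ suc n ∎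
  where open ≡-Reasoning

∈-bitStrings : ∀ w → w ∈ bitStrings (length w)
∈-bitStrings []          = here refl
∈-bitStrings (false ∷ w) = ∈-++⁺ˡ (∈-map⁺ (false ∷_) (∈-bitStrings w))
∈-bitStrings (true  ∷ w) = ∈-++⁺ʳ (map (false ∷_) (bitStrings (length w))) (∈-map⁺ (true ∷_) (∈-bitStrings w))

tailsAfter : Bool → List (List Bool) → List (List Bool)
tailsAfter b     []                  = []
tailsAfter b     ([] ∷ ws)           = tailsAfter b ws
tailsAfter false ((false ∷ w) ∷ ws)  = w ∷ tailsAfter false ws
tailsAfter false ((true  ∷ w) ∷ ws)  = tailsAfter false ws
tailsAfter true  ((true  ∷ w) ∷ ws)  = w ∷ tailsAfter true ws
tailsAfter true  ((false ∷ w) ∷ ws)  = tailsAfter true ws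

length-tailsAfter : ∀ ws → length (tailsAfter false ws) + length (tailsAfter true ws) ≤ length ws
length-tailsAfter []                 = z≤n
length-tailsAfter ([] ∷ ws)          = m≤n⇒m≤1+n (length-tailsAfter ws)
length-tailsAfter ((false ∷ w) ∷ ws) = s≤s (length-tailsAfter ws)
length-tailsAfter ((true  ∷ w) ∷ ws) = ≤-trans (≤-reflexive (+-suc _ _)) (s≤s (length-tailsAfter ws))

∈-tailsAfter : ∀ b {w} ws → (b ∷ w) ∈ ws → w ∈ tailsAfter b ws
∈-tailsAfter false ((false ∷ w) ∷ ws) (here refl) = here refl
∈-tailsAfter true  ((true  ∷ w) ∷ ws) (here refl) = here refl
∈-tailsAfter b     ([] ∷ ws)          (there w∈)  = ∈-tailsAfter b ws w∈
∈-tailsAfter false ((false ∷ _) ∷ ws) (there w∈)  = there (∈-tailsAfter false ws w∈)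
∈-tailsAfter false ((true  ∷ _) ∷ ws) (there w∈)  = ∈-tailsAfter false ws w∈
∈-tailsAfter true  ((true  ∷ _) ∷ ws) (there w∈)  = there (∈-tailsAfter true ws w∈)
∈-tailsAfter true  ((false ∷ _) ∷ ws) (there w∈)  = ∈-tailsAfter true ws w∈

-- Fewer than 2ⁿ strings cannot cover {0,1}ⁿ: one of the two halves by first bit is short enough.
∃-bitString∉ : ∀ n (ws : List (List Bool)) → length ws < 2 ^ n → ∃ λ y → length y ≡ n × y ∉ ws
∃-bitString∉ zero    []      _        = [] , refl , λ ()
∃-bitString∉ zero    (_ ∷ _) (s≤s ())
∃-bitString∉ (suc n) ws      |ws|<2^[1+n] with length (tailsAfter false ws) <? 2 ^ n
... | yes short =
  let y , |y| , y∉ = ∃-bitString∉ n (tailsAfter false ws) short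
  in false ∷ y , cong suc |y| , λ y∈ → y∉ (∈-tailsAfter false ws y∈)
... | no long =
  let y , |y| , y∉ = ∃-bitString∉ n (tailsAfter true ws) short
  in true ∷ y , cong suc |y| , λ y∈ → y∉ (∈-tailsAfter true ws y∈)
  where
  short : length (tailsAfter true ws) < 2 ^ n
  short = +-cancelˡ-< (2 ^ n) _ _ (begin-strict
    2 ^ n + length (tailsAfter true ws)
      ≤⟨ +-monoˡ-≤ _ (≮⇒≥ long) ⟩
    length (tailsAfter false ws) + length (tailsAfter true ws)
      ≤⟨ length-tailsAfter ws ⟩
    length ws
      <⟨ |ws|<2^[1+n] ⟩
    2 ^ n + (2 ^ n + 0)
      ≡⟨ cong (2 ^ n +_) (+-identityʳ _) ⟩
    2 ^ n + 2 ^ n ∎)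
    where open ≤-Reasoning

slice : (n k : ℕ) → List (Vec Bool n)
slice zero    zero    = [] ∷ []
slice zero    (suc k) = []
slice (suc n) zero    = map (false ∷_) (slice n zero)
slice (suc n) (suc k) = map (true ∷_) (slice n k) ++ map (false ∷_) (slice n (suc k))

length-slice : ∀ n k → length (slice n k) ≡ n C k
length-slice zero    zero    = refl
length-slice zero    (suc k) = refl
length-slice (suc n) zero    = trans (length-map _ (slice n zero)) (length-slice n zero)
length-slice (suc n) (suc k) = begin
  length (map (true ∷_) (slice n k) ++ map (false ∷_) (slice n (suc k)))
    ≡⟨ length-++ (map (true ∷_) (slice n k)) ⟩
  length (map (true ∷_) (slice n k)) + length (map (false ∷_) (slice n (suc k)))
    ≡⟨ cong₂ _+_ (trans (length-map _ (slice n k)) (length-slice n k))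
                 (trans (length-map _ (slice n (suc k))) (length-slice n (suc k))) ⟩
  n C k + n C suc k
    ≡⟨ nCk+nC[k+1]≡[n+1]C[k+1] n k ⟩
  suc n C suc k ∎
  where open ≡-Reasoning

slice-weight : ∀ n k → All (λ v → weight v ≡ k) (slice n k)
slice-weight zero    zero    = refl ∷ []
slice-weight zero    (suc k) = []
slice-weight (suc n) zero    = Allₚ.map⁺ (slice-weight n zero)
slice-weight (suc n) (suc k) =
  Allₚ.++⁺ (Allₚ.map⁺ (All.map (cong suc) (slice-weight n k))) (Allₚ.map⁺ (slice-weight n (suc k)))

slice-unique : ∀ n k → Unique (slice n k)
slice-unique zero    zero    = [] AllPairs.∷ AllPairs.[]
slice-unique zero    (suc k) = AllPairs.[]
slice-unique (suc n) zero    = Uniqueₚ.map⁺ Vecₚ.∷-injectiveʳ (slice-unique n zero)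
slice-unique (suc n) (suc k) =
  Uniqueₚ.++⁺ (Uniqueₚ.map⁺ Vecₚ.∷-injectiveʳ (slice-unique n k))
             (Uniqueₚ.map⁺ Vecₚ.∷-injectiveʳ (slice-unique n (suc k))) disjoint
  where
  disjoint : ∀ {v} → ¬ (v ∈ map (true ∷_) (slice n k) × v ∈ map (false ∷_) (slice n (suc k)))
  disjoint (v∈₁ , v∈₂) with ∈-map⁻ (true ∷_) v∈₁ | ∈-map⁻ (false ∷_) v∈₂
  ... | _ , _ , refl | _ , _ , ()

map-proj₁-zip : ∀ {A B : Set} (xs : List A) (ys : List B) → length ys ≡ length xs → map proj₁ (zip xs ys) ≡ xs
map-proj₁-zip []       []       _     = refl
map-proj₁-zip (x ∷ xs) (y ∷ ys) |ys|≡ = cong (x ∷_) (map-proj₁-zip xs ys (suc-injective |ys|≡))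

map≡-zip : ∀ {A : Set} (f : A → Bool) (xs : List A) ys → length ys ≡ length xs →
           All (λ xy → f (proj₁ xy) ≡ proj₂ xy) (zip xs ys) → map f xs ≡ ys
map≡-zip f []       []       _     []              = refl
map≡-zip f (x ∷ xs) (y ∷ ys) |ys|≡ (fx≡y ∷ agrees) = cong₂ _∷_ fx≡y (map≡-zip f xs ys (suc-injective |ys|≡) agrees)

module _ (c d L : ℕ) (d≤2^L : d ≤ 2 ^ L) where
  open FormulaCode c d L

  hardLabels : (xs : List (Vec Bool d)) → Σ (List Bool) λ ys → length ys ≡ length xs ×
    ((F : Formula c d) → map (eval F) xs ≡ ys → length xs ≤ length (encode F))
  hardLabels []             = [] , refl , λ _ _ → z≤n
  hardLabels xs@(_ ∷ tail) = ys , |ys| , long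
    where
    n = length tail
    labelling : List Bool → List Bool
    labelling w = map (proj₁ (decode n w)) xs
    missed = ∃-bitString∉ (suc n) (map labelling (bitStrings n))
      (subst (_< 2 ^ suc n) (sym (trans (length-map labelling (bitStrings n)) (length-bitStrings n)))
             (^-monoʳ-< 2 (s≤s (s≤s z≤n)) (n<1+n n)))
    ys = proj₁ missed
    |ys| = proj₁ (proj₂ missed)
    ys∉ = proj₂ (proj₂ missed)
    long : (F : Formula c d) → map (eval F) xs ≡ ys → length xs ≤ length (encode F)
    long F evals with length (encode F) ≤? n
    ... | no  code-long = ≰⇒> code-long
    ... | yes code-short = ⊥-elim (ys∉ (subst (_∈ map labelling (bitStrings n)) labelled listed))
      where
      w = encode F ++ replicate (n ∸ length (encode F)) false
      |w| : length w ≡ n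
      |w| = trans (length-++ (encode F)) (trans (cong (length (encode F) +_) (length-replicate _)) (m+[n∸m]≡n code-short))
      listed : labelling w ∈ map labelling (bitStrings n)
      listed = ∈-map⁺ labelling (subst (λ m → w ∈ bitStrings m) |w| (∈-bitStrings w))
      labelled : labelling w ≡ ys
      labelled = trans (map-cong (proj₂ (decode-encode d≤2^L n F (≤-trans (size≤length-encode F) code-short) _)) xs) evals

  hardSample : (xs : List (Vec Bool d)) → Σ (List (Vec Bool d × Bool)) λ ps → map proj₁ ps ≡ xs ×
    ((f : Vec Bool d → Bool) → All (λ xy → f (proj₁ xy) ≡ proj₂ xy) ps →
     (F : Formula c d) → ((x : Vec Bool d) → eval F x ≡ f x) → length xs ≤ codeWidth * size F)
  hardSample xs =
    let ys , |ys| , long = hardLabels xs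
    in zip xs ys , map-proj₁-zip xs ys |ys| , λ f agrees F F≗f →
         ≤-trans (long F (trans (map-cong F≗f xs) (map≡-zip f xs ys |ys| agrees))) (length-encode F)

n≤2^⌈log₂n⌉ : ∀ n → n ≤ 2 ^ ⌈log₂ n ⌉
n≤2^⌈log₂n⌉ n = go n (<-wellFounded n)
  where
  go : ∀ n (rec : Acc _<_ n) → n ≤ 2 ^ ⌈log2⌉ n rec
  go zero                _         = z≤n
  go (suc zero)          _         = s≤s z≤n
  go (suc (suc n)) (acc rec) = ≤-trans 2+n≤2*[1+⌈n/2⌉] (*-monoʳ-≤ 2 (go (suc ⌈ n /2⌉) (rec (⌈n/2⌉<n n))))
    where
    2+n≤2*[1+⌈n/2⌉] : suc (suc n) ≤ 2 * suc ⌈ n /2⌉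
    2+n≤2*[1+⌈n/2⌉] = begin
      suc (suc n)                   ≡⟨ cong (λ z → suc (suc z)) (⌊n/2⌋+⌈n/2⌉≡n n) ⟨
      suc (suc (⌊ n /2⌋ + ⌈ n /2⌉)) ≤⟨ s≤s (s≤s (+-monoˡ-≤ _ (⌊n/2⌋≤⌈n/2⌉ n))) ⟩
      suc (suc (⌈ n /2⌉ + ⌈ n /2⌉)) ≡⟨ cong suc (+-suc _ _) ⟨
      suc ⌈ n /2⌉ + suc ⌈ n /2⌉     ≡⟨ cong (suc ⌈ n /2⌉ +_) (+-identityʳ _) ⟨
      2 * suc ⌈ n /2⌉               ∎
      where open ≤-Reasoning

m+n≤[1+m]*n : ∀ m {n} → 1 ≤ n → m + n ≤ suc m * n
m+n≤[1+m]*n m {n@(suc _)} _ = subst (m + n ≤_) (+-comm (m * n) n) (+-monoˡ-≤ n (m≤m*n m n))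

sampleBound⇒sizeBound : ∀ K L s m X N → X * X ≤ N * N * (4 * m) → N ≤ K * L * s →
        1 * 1 * X * X ≤ 2 * K * (2 * K) * (s * s) * (2 * m) * (L * L)
sampleBound⇒sizeBound K L s m X N X²≤N²*4m N≤KLs = begin
  1 * 1 * X * X                                  ≡⟨ cong (_* X) (*-identityˡ X) ⟩
  X * X                                          ≤⟨ X²≤N²*4m ⟩
  N * N * (4 * m)                                ≤⟨ *-monoˡ-≤ (4 * m) (*-mono-≤ N≤KLs N≤KLs) ⟩
  K * L * s * (K * L * s) * (4 * m)              ≤⟨ m≤m+n _ _ ⟩
  K * L * s * (K * L * s) * (4 * m) + (K * L * s * (K * L * s) * (4 * m) + 0)
                                                 ≡⟨ regroup K L s m ⟨
  2 * K * (2 * K) * (s * s) * (2 * m) * (L * L)  ∎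
  where
  open ≤-Reasoning
  regroup : ∀ K L s m → 2 * K * (2 * K) * (s * s) * (2 * m) * (L * L) ≡ 2 * (K * L * s * (K * L * s) * (4 * m))
  regroup = solve-∀

corollary2p1 : (c : ℕ) → 2 ≤ c →
    Σ ℕ λ p → Σ ℕ λ q → 0 < p × 0 < q ×
      ((m : ℕ) → 1 ≤ m →
        Σ (List (Vec Bool (2 * m) × Bool)) λ ps →
          length ps ≡ (2 * m) C m ×
          Unique (map proj₁ ps) ×
          All (λ xy → weight (proj₁ xy) ≡ m) ps ×
          ((f : Vec Bool (2 * m) → Bool) →
            All (λ xy → f (proj₁ xy) ≡ proj₂ xy) ps →
            (F : Formula c (2 * m)) →
            ((x : Vec Bool (2 * m)) → eval F x ≡ f x) →
            p * p * (2 ^ (2 * m)) * (2 ^ (2 * m))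
              ≤ q * q * (size F * size F) * (2 * m) * (⌈log₂ (2 * m) ⌉ * ⌈log₂ (2 * m) ⌉)))
corollary2p1 c _ = 1 , 2 * K , s≤s z≤n , s≤s z≤n , λ where
    zero ()
    (suc j) _ →
      let m = suc j
          L = ⌈log₂ (2 * m) ⌉
          xs = slice (2 * m) m
          ps , ps₁≡xs , hard = hardSample c (2 * m) L (n≤2^⌈log₂n⌉ (2 * m)) xs
          codeWidth≤K*L = m+n≤[1+m]*n (4 + c + 2 ^ c) (⌈log₂⌉-mono-≤ {2} {2 * m} (*-monoʳ-≤ 2 (s≤s z≤n)))
      in ps
       , trans (sym (length-map proj₁ ps)) (trans (cong length ps₁≡xs) (length-slice (2 * m) m))
       , subst Unique (sym ps₁≡xs) (slice-unique (2 * m) m)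
       , Allₚ.map⁻ (subst (All _) (sym ps₁≡xs) (slice-weight (2 * m) m))
       , λ f agrees F F≗f →
           sampleBound⇒sizeBound K L (size F) m (2 ^ (2 * m)) ((2 * m) C m) (centralBinomial-lower-bound j)
           (≤-trans (≤-trans (≤-reflexive (sym (length-slice (2 * m) m))) (hard f agrees F F≗f))
                    (*-monoˡ-≤ (size F) codeWidth≤K*L))
  where
  K = 5 + c + 2 ^ c
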